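{- Let $G$ be a finite abelian group and $S$ a sequence over $G$ such that $N_h(S) = 2^{|S|-D(G)+1}$ for some $h \in G$. Then $N_g(S) \ge 2^{|S|-D(G)+1}$ for all $g \in G$.
   Context: A sequence over $G$ is a finite unordered list $S = g_1 \cdots g_m$ of elements of $G$ with repetition allowed; $|S| = m$. For $g\in G$, $N_g(S) = |\{I \subseteq [1,m] : \sum_{i\in I} g_i = g\}|$ (the empty index set contributes to $N_0$). $D(G)$ is the smallest positive integer $\ell$ such that every sequence over $G$ of length at least $\ell$ has a nonempty subsequence with sum $0$. -}

module Defs where

open import Level using (_⊔_)
open import Algebra.Bundles using (AbelianGroup)
open import Data.Bool using (Bool; true; false)
open import Data.Nat using (ℕ; zero; suc; _≤_)
open import Data.List using (List; []; _∷_; [_]; length; map; _++_; filter)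
open import Data.List.Relation.Unary.Any using (Any)
open import Data.Vec using (Vec; []; _∷_)
import Data.Vec.Relation.Unary.Any as VAny
open import Data.Product using (Σ; ∃; _×_)
open import Relation.Binary.Core using (Rel)
open import Relation.Binary.Definitions using (Decidable)
open import Relation.Binary.PropositionalEquality using (_≡_)

module _ {c ℓ} (G : AbelianGroup c ℓ) where
  open AbelianGroup G

  -- a sequence over G: a finite list (order is irrelevant for everything below)
  Sequence : Set c
  Sequence = List Carrier

  -- an index set I ⊆ [1,m] of a sequence of length m, as a characteristic vector
  IndexSet : Sequence → Set
  IndexSet S = Vec Bool (length S)

  allIndexSets : (n : ℕ) → List (Vec Bool n)
  allIndexSets zero = [ [] ]
  allIndexSets (suc n) = map (false ∷_) (allIndexSets n) ++ map (true ∷_) (allIndexSets n)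

  subSum : (S : Sequence) → IndexSet S → Carrier
  subSum [] [] = ε
  subSum (x ∷ S) (true ∷ I) = x ∙ subSum S I
  subSum (x ∷ S) (false ∷ I) = subSum S I

  -- N_g(S) = |{ I ⊆ [1,m] : ∑_{i∈I} g_i = g }|  (empty I counted for g = 0)
  N : Decidable _≈_ → Carrier → Sequence → ℕ
  N _≟_ g S = length (filter (λ I → subSum S I ≟ g) (allIndexSets (length S)))

  NonemptyIndexSet : ∀ {n} → Vec Bool n → Set
  NonemptyIndexSet I = VAny.Any (_≡ true) I

  HasZeroSumSubseq : Sequence → Set ℓ
  HasZeroSumSubseq S = Σ (IndexSet S) λ I → NonemptyIndexSet I × (subSum S I ≈ ε)

  ZeroSumBound : ℕ → Set (c ⊔ ℓ)
  ZeroSumBound k = (S : Sequence) → k ≤ length S → HasZeroSumSubseq S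

  IsDavenportConstant : ℕ → Set (c ⊔ ℓ)
  IsDavenportConstant D = (1 ≤ D) × ZeroSumBound D × ((k : ℕ) → 1 ≤ k → ZeroSumBound k → D ≤ k)

  IsFinite : Set (c ⊔ ℓ)
  IsFinite = Σ (List Carrier) λ xs → (x : Carrier) → Any (x ≈_) xs

module Submission where

-- If g = σ(S_I) and |S| ≥ D, invert the terms of S indexed by I; the resulting sequence
-- still has length ≥ D, and a nonempty zero-sum subsequence Z of it turns I into a second
-- representation I △ Z of g that disagrees with I at some index i.  So g is represented
-- both with and without sᵢ, and N_g(S) = N_g(S∖sᵢ) + N_{g−sᵢ}(S∖sᵢ) gives, by induction,
-- N_g(S) ≥ 2^{|S|−D+1} for every g represented in S.
-- For the proposition prepend x = g − h to S: g is represented in xS, so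
-- N_g(S) + N_h(S) = N_g(xS) ≥ 2^{|S|−D+2}, and N_h(S) = 2^{|S|−D+1} leaves N_g(S) ≥ 2^{|S|−D+1}.

open import Defs
open import Algebra.Bundles using (AbelianGroup)
open import Data.Nat using (ℕ; _+_; _*_; _^_; _≤_)
open import Data.List using (List; length)
open import Relation.Binary.Definitions using (Decidable)
open import Relation.Binary.PropositionalEquality using (_≡_)

open import Data.Bool using (Bool; true; false; not; _xor_; if_then_else_)
open import Data.Nat using (suc; _<_; _≤?_; z<s; >-nonZero)
open import Data.Nat.Properties
open import Data.Nat.Induction using (<-wellFounded)
open import Data.Fin using (Fin; zero; suc)
open import Data.List using ([]; _∷_; map; _++_; filter; removeAt; lookup)
open import Data.List.Properties using (filter-some; filter-++; filter-≐; length-++; length-removeAt′)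
open import Data.List.Membership.Propositional using (_∈_; lose)
open import Data.List.Membership.Propositional.Properties using (∈-map⁺; ∈-++⁺ˡ; ∈-++⁺ʳ)
open import Data.List.Relation.Unary.Any using (Any; here; there; satisfied)
open import Data.Vec using (Vec; []; _∷_)
import Data.Vec as Vec
import Data.Vec.Relation.Unary.Any as VecAny
open import Data.Product using (Σ; _×_; _,_)
open import Function using (_on_)
open import Induction.WellFounded using (Acc; acc)
import Relation.Binary.Construct.On as On
open import Relation.Nullary using (yes; no; does)
open import Relation.Unary using (Pred) renaming (Decidable to Decidable₁)
open import Relation.Binary.PropositionalEquality using (refl; sym; cong; cong₂; subst; module ≡-Reasoning)
import Relation.Binary.Reasoning.Setoid as SetoidReasoning
open import Algebra.Properties.CommutativeSemigroup +-commutativeSemigroup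
  using () renaming (interchange to +-interchange)

module _ {a p} {A : Set a} {P : Pred A p} (P? : Decidable₁ P) where

  filter-some⁻ : ∀ xs → 0 < length (filter P? xs) → Any P xs
  filter-some⁻ (x ∷ xs) pos with P? x
  ... | yes px = here px
  ... | no _ = there (filter-some⁻ xs pos)

  length-filter-map : ∀ {b} {B : Set b} (f : B → A) xs →
                      length (filter P? (map f xs)) ≡ length (filter (λ x → P? (f x)) xs)
  length-filter-map f [] = refl
  length-filter-map f (x ∷ xs) with does (P? (f x))
  ... | true = cong suc (length-filter-map f xs)
  ... | false = length-filter-map f xs

m*n>0⇒m>0 : ∀ m n → 0 < m * n → 0 < m
m*n>0⇒m>0 (suc m) n _ = z<s

2^[1+n]≡2^n+2^n : ∀ n → 2 ^ suc n ≡ 2 ^ n + 2 ^ n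
2^[1+n]≡2^n+2^n n = cong (2 ^ n +_) (+-identityʳ (2 ^ n))

module _ {c ℓ} (G : AbelianGroup c ℓ) where
  open AbelianGroup G renaming (refl to ≈-refl; sym to ≈-sym; trans to ≈-trans)
  open import Algebra.Properties.Group group using (y≈x\\z; \\-leftDividesˡ; //-rightDividesˡ)
  open import Algebra.Properties.CommutativeSemigroup commutativeSemigroup
    using (interchange; x∙yz≈y∙xz)

  σ : (S : Sequence G) → IndexSet G S → Carrier
  σ = subSum G

  Representation : Sequence G → Carrier → Set ℓ
  Representation S g = Σ (IndexSet G S) λ I → σ S I ≈ g

  twist : (S : Sequence G) → IndexSet G S → Sequence G
  twist [] [] = []
  twist (x ∷ S) (b ∷ I) = (if b then x ⁻¹ else x) ∷ twist S I

  length-twist : ∀ S I → length (twist S I) ≡ length S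
  length-twist [] [] = refl
  length-twist (x ∷ S) (b ∷ I) = cong suc (length-twist S I)

  flip : ∀ S I → IndexSet G (twist S I) → IndexSet G S
  flip [] [] [] = []
  flip (x ∷ S) (b ∷ I) (z ∷ Z) = (z xor b) ∷ flip S I Z

  σ-flip : ∀ S I Z → σ S (flip S I Z) ≈ σ S I ∙ σ (twist S I) Z
  σ-flip [] [] [] = ≈-sym (identityˡ ε)
  σ-flip (x ∷ S) (false ∷ I) (false ∷ Z) = σ-flip S I Z
  σ-flip (x ∷ S) (false ∷ I) (true ∷ Z) = ≈-trans (∙-congˡ (σ-flip S I Z)) (x∙yz≈y∙xz x _ _)
  σ-flip (x ∷ S) (true ∷ I) (false ∷ Z) = ≈-trans (∙-congˡ (σ-flip S I Z)) (≈-sym (assoc x _ _))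
  σ-flip (x ∷ S) (true ∷ I) (true ∷ Z) = begin
    σ S (flip S I Z)                  ≈⟨ σ-flip S I Z ⟩
    σ S I ∙ σ T Z                     ≈⟨ identityˡ _ ⟨
    ε ∙ (σ S I ∙ σ T Z)               ≈⟨ ∙-congʳ (inverseʳ x) ⟨
    (x ∙ x ⁻¹) ∙ (σ S I ∙ σ T Z)      ≈⟨ interchange x (x ⁻¹) _ _ ⟩
    (x ∙ σ S I) ∙ (x ⁻¹ ∙ σ T Z)      ∎
    where
    T : Sequence G
    T = twist S I
    open SetoidReasoning setoid

  flip-differs : ∀ S I Z → NonemptyIndexSet G Z →
                 Σ (Fin (length S)) λ i → Vec.lookup (flip S I Z) i ≡ not (Vec.lookup I i)
  flip-differs [] [] [] ()
  flip-differs (x ∷ S) (b ∷ I) (z ∷ Z) (VecAny.here refl) = zero , refl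
  flip-differs (x ∷ S) (b ∷ I) (z ∷ Z) (VecAny.there nonempty)
    with i , differs ← flip-differs S I Z nonempty = suc i , differs

  restrict : (S : Sequence G) (i : Fin (length S)) → IndexSet G S → IndexSet G (removeAt S i)
  restrict (x ∷ S) zero (b ∷ I) = I
  restrict (x ∷ S) (suc i) (b ∷ I) = b ∷ restrict S i I

  σ-restrict-false : ∀ S i I → Vec.lookup I i ≡ false → σ (removeAt S i) (restrict S i I) ≈ σ S I
  σ-restrict-false (x ∷ S) zero (false ∷ I) _ = ≈-refl
  σ-restrict-false (x ∷ S) (suc i) (false ∷ I) Iᵢ = σ-restrict-false S i I Iᵢ
  σ-restrict-false (x ∷ S) (suc i) (true ∷ I) Iᵢ = ∙-congˡ (σ-restrict-false S i I Iᵢ)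

  σ-restrict-true : ∀ S i I → Vec.lookup I i ≡ true →
                    lookup S i ∙ σ (removeAt S i) (restrict S i I) ≈ σ S I
  σ-restrict-true (x ∷ S) zero (true ∷ I) _ = ≈-refl
  σ-restrict-true (x ∷ S) (suc i) (false ∷ I) Iᵢ = σ-restrict-true S i I Iᵢ
  σ-restrict-true (x ∷ S) (suc i) (true ∷ I) Iᵢ =
    ≈-trans (x∙yz≈y∙xz _ x _) (∙-congˡ (σ-restrict-true S i I Iᵢ))

  Splits : (S : Sequence G) → Carrier → Fin (length S) → Set ℓ
  Splits S g i = Representation (removeAt S i) g × Representation (removeAt S i) (lookup S i ⁻¹ ∙ g)

  representations-avoiding-and-using⇒splits :
    ∀ S i {g I J} → Vec.lookup I i ≡ false → Vec.lookup J i ≡ true →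
    σ S I ≈ g → σ S J ≈ g → Splits S g i
  representations-avoiding-and-using⇒splits S i {g} {I} {J} Iᵢ Jᵢ σI σJ =
    (restrict S i I , ≈-trans (σ-restrict-false S i I Iᵢ) σI) ,
    (restrict S i J , y≈x\\z _ _ g (≈-trans (σ-restrict-true S i J Jᵢ) σJ))

  module _ {D} (zeroSum : ZeroSumBound G D) where

    long⇒differing-representation :
      ∀ S {g} I → D ≤ length S → σ S I ≈ g →
      Σ (IndexSet G S) λ J → σ S J ≈ g × Σ (Fin (length S)) λ i → Vec.lookup J i ≡ not (Vec.lookup I i)
    long⇒differing-representation S {g} I long σI
      with Z , nonempty , σZ ← zeroSum (twist S I) (subst (D ≤_) (sym (length-twist S I)) long) =
      flip S I Z , σJ , flip-differs S I Z nonempty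
      where
      σJ : σ S (flip S I Z) ≈ g
      σJ = begin
        σ S (flip S I Z)          ≈⟨ σ-flip S I Z ⟩
        σ S I ∙ σ (twist S I) Z   ≈⟨ ∙-congˡ σZ ⟩
        σ S I ∙ ε                 ≈⟨ identityʳ _ ⟩
        σ S I                     ≈⟨ σI ⟩
        g                         ∎
        where open SetoidReasoning setoid

    long⇒splits : ∀ S {g} → D ≤ length S → Representation S g → Σ (Fin (length S)) (Splits S g)
    long⇒splits S long (I , σI)
      with J , σJ , i , Jᵢ ← long⇒differing-representation S I long σI
      with Vec.lookup I i in Iᵢ
    ... | false = i , representations-avoiding-and-using⇒splits S i Iᵢ Jᵢ σI σJ
    ... | true = i , representations-avoiding-and-using⇒splits S i Jᵢ Iᵢ σJ σI

  ∈-allIndexSets : ∀ {n} (I : Vec Bool n) → I ∈ allIndexSets G n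
  ∈-allIndexSets [] = here refl
  ∈-allIndexSets (false ∷ I) = ∈-++⁺ˡ (∈-map⁺ (false ∷_) (∈-allIndexSets I))
  ∈-allIndexSets (true ∷ I) = ∈-++⁺ʳ _ (∈-map⁺ (true ∷_) (∈-allIndexSets I))

  module _ (_≟_ : Decidable _≈_) where

    count : Carrier → Sequence G → ℕ
    count g S = N G _≟_ g S

    count-pos : ∀ S {g} → Representation S g → 0 < count g S
    count-pos S {g} (I , σI) = filter-some (λ J → σ S J ≟ g) (lose (∈-allIndexSets I) σI)

    count-pos⁻¹ : ∀ S {g} → 0 < count g S → Representation S g
    count-pos⁻¹ S {g} pos = satisfied (filter-some⁻ (λ J → σ S J ≟ g) (allIndexSets G (length S)) pos)

    count-cong : ∀ S {g h} → g ≈ h → count g S ≡ count h S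
    count-cong S {g} {h} g≈h =
      cong length (filter-≐ (λ I → σ S I ≟ g) (λ I → σ S I ≟ h)
                            ((λ e → ≈-trans e g≈h) , (λ e → ≈-trans e (≈-sym g≈h)))
                            (allIndexSets G (length S)))

    count-∷ : ∀ x S g → count g (x ∷ S) ≡ count g S + count (x ⁻¹ ∙ g) S
    count-∷ x S g = begin
      length (filter P? (map (false ∷_) A ++ map (true ∷_) A))
        ≡⟨ cong length (filter-++ P? (map (false ∷_) A) _) ⟩
      length (filter P? (map (false ∷_) A) ++ filter P? (map (true ∷_) A))
        ≡⟨ length-++ (filter P? (map (false ∷_) A)) ⟩
      length (filter P? (map (false ∷_) A)) + length (filter P? (map (true ∷_) A))
        ≡⟨ cong₂ _+_ (length-filter-map P? (false ∷_) A) (length-filter-map P? (true ∷_) A) ⟩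
      count g S + length (filter (λ I → (x ∙ σ S I) ≟ g) A)
        ≡⟨ cong (λ n → count g S + n) (cong length (filter-≐ _ (λ I → σ S I ≟ (x ⁻¹ ∙ g)) (y≈x\\z x _ g , unshift) A)) ⟩
      count g S + count (x ⁻¹ ∙ g) S ∎
      where
      open ≡-Reasoning
      A : List (Vec Bool (length S))
      A = allIndexSets G (length S)
      P? : Decidable₁ (λ I → σ (x ∷ S) I ≈ g)
      P? I = σ (x ∷ S) I ≟ g
      unshift : ∀ {y} → y ≈ x ⁻¹ ∙ g → x ∙ y ≈ g
      unshift e = ≈-trans (∙-congˡ e) (\\-leftDividesˡ x g)

    count-removeAt : ∀ S i g →
                     count g S ≡ count g (removeAt S i) + count (lookup S i ⁻¹ ∙ g) (removeAt S i)
    count-removeAt (x ∷ S) zero g = count-∷ x S g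
    count-removeAt (x ∷ S) (suc i) g = begin
      count g (x ∷ S)
        ≡⟨ count-∷ x S g ⟩
      count g S + count (x ⁻¹ ∙ g) S
        ≡⟨ cong₂ _+_ (count-removeAt S i g) (count-removeAt S i (x ⁻¹ ∙ g)) ⟩
      (count g R + count (y ⁻¹ ∙ g) R) + (count (x ⁻¹ ∙ g) R + count (y ⁻¹ ∙ (x ⁻¹ ∙ g)) R)
        ≡⟨ cong (λ n → (count g R + count (y ⁻¹ ∙ g) R) + (count (x ⁻¹ ∙ g) R + n))
                (count-cong R (x∙yz≈y∙xz (y ⁻¹) (x ⁻¹) g)) ⟩
      (count g R + count (y ⁻¹ ∙ g) R) + (count (x ⁻¹ ∙ g) R + count (x ⁻¹ ∙ (y ⁻¹ ∙ g)) R)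
        ≡⟨ +-interchange (count g R) (count (y ⁻¹ ∙ g) R) (count (x ⁻¹ ∙ g) R) _ ⟩
      (count g R + count (x ⁻¹ ∙ g) R) + (count (y ⁻¹ ∙ g) R + count (x ⁻¹ ∙ (y ⁻¹ ∙ g)) R)
        ≡⟨ cong₂ _+_ (count-∷ x R g) (count-∷ x R (y ⁻¹ ∙ g)) ⟨
      count g (x ∷ R) + count (y ⁻¹ ∙ g) (x ∷ R) ∎
      where
      open ≡-Reasoning
      R : Sequence G
      R = removeAt S i
      y : Carrier
      y = lookup S i

    module _ {D} (zeroSum : ZeroSumBound G D) where

      -- N_g(S) ≥ 2^{|S|−D+1}, multiplied out by 2^D to avoid truncated subtraction.
      count-lowerBound-acc : ∀ S {g} → Acc (_<_ on length) S → Representation S g →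
                             2 ^ suc (length S) ≤ count g S * 2 ^ D
      count-lowerBound-acc S {g} (acc smaller) rep with D ≤? length S
      ... | no short = begin
        2 ^ suc (length S)  ≤⟨ ^-monoʳ-≤ 2 (≰⇒> short) ⟩
        2 ^ D               ≤⟨ m≤n*m (2 ^ D) (count g S) {{>-nonZero (count-pos S rep)}} ⟩
        count g S * 2 ^ D   ∎
        where open ≤-Reasoning
      ... | yes long with i , rep₁ , rep₂ ← long⇒splits zeroSum S long rep = begin
        2 ^ suc (length S)                               ≡⟨ cong (λ n → 2 ^ suc n) (length-removeAt′ S i) ⟩
        2 ^ suc (suc (length R))                         ≡⟨ 2^[1+n]≡2^n+2^n (suc (length R)) ⟩
        2 ^ suc (length R) + 2 ^ suc (length R)          ≤⟨ +-mono-≤ (bound rep₁) (bound rep₂) ⟩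
        count g R * 2 ^ D + count (y ⁻¹ ∙ g) R * 2 ^ D   ≡⟨ *-distribʳ-+ (2 ^ D) (count g R) _ ⟨
        (count g R + count (y ⁻¹ ∙ g) R) * 2 ^ D         ≡⟨ cong (_* 2 ^ D) (count-removeAt S i g) ⟨
        count g S * 2 ^ D                                ∎
        where
        open ≤-Reasoning
        R : Sequence G
        R = removeAt S i
        y : Carrier
        y = lookup S i
        bound : ∀ {h} → Representation R h → 2 ^ suc (length R) ≤ count h R * 2 ^ D
        bound = count-lowerBound-acc R (smaller (≤-reflexive (sym (length-removeAt′ S i))))

      count-lowerBound : ∀ S {g} → Representation S g → 2 ^ suc (length S) ≤ count g S * 2 ^ D
      count-lowerBound S = count-lowerBound-acc S (On.wellFounded length <-wellFounded S)

      tight⇒count-lowerBound : ∀ S {h} → Representation S h → count h S * 2 ^ D ≤ 2 ^ suc (length S) →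
                               ∀ g → 2 ^ suc (length S) ≤ count g S * 2 ^ D
      tight⇒count-lowerBound S {h} (I , σI) tight g = +-cancelʳ-≤ B B (count g S * 2 ^ D) (begin
        B + B                                      ≡⟨ 2^[1+n]≡2^n+2^n (suc (length S)) ⟨
        2 ^ suc (length (x ∷ S))                   ≤⟨ count-lowerBound (x ∷ S) (true ∷ I , σ[x∷I]) ⟩
        count g (x ∷ S) * 2 ^ D                    ≡⟨ cong (_* 2 ^ D) (count-∷ x S g) ⟩
        (count g S + count (x ⁻¹ ∙ g) S) * 2 ^ D   ≡⟨ cong (λ n → (count g S + n) * 2 ^ D) (count-cong S x⁻¹g≈h) ⟩
        (count g S + count h S) * 2 ^ D            ≡⟨ *-distribʳ-+ (2 ^ D) (count g S) (count h S) ⟩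
        count g S * 2 ^ D + count h S * 2 ^ D      ≤⟨ +-monoʳ-≤ (count g S * 2 ^ D) tight ⟩
        count g S * 2 ^ D + B                      ∎)
        where
        open ≤-Reasoning
        B : ℕ
        B = 2 ^ suc (length S)
        x : Carrier
        x = g ∙ h ⁻¹
        σ[x∷I] : x ∙ σ S I ≈ g
        σ[x∷I] = ≈-trans (∙-congˡ σI) (//-rightDividesˡ h g)
        x⁻¹g≈h : x ⁻¹ ∙ g ≈ h
        x⁻¹g≈h = ≈-sym (y≈x\\z x h g (//-rightDividesˡ h g))

proposition2p3 : ∀ {c ℓ} (G : AbelianGroup c ℓ) → IsFinite G
    → (_≟_ : Decidable (AbelianGroup._≈_ G))
    → (D : ℕ) → IsDavenportConstant G D
    → (S : List (AbelianGroup.Carrier G))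
    → (h : AbelianGroup.Carrier G)
    → N G _≟_ h S * 2 ^ D ≡ 2 ^ (length S + 1)
    → (g : AbelianGroup.Carrier G)
    → 2 ^ (length S + 1) ≤ N G _≟_ g S * 2 ^ D
proposition2p3 G _ _≟_ D (_ , zeroSum , _) S h tight g rewrite +-comm (length S) 1 =
  tight⇒count-lowerBound G _≟_ zeroSum S rep (≤-reflexive tight) g
  where
  rep : Representation G S h
  rep = count-pos⁻¹ G _≟_ S (m*n>0⇒m>0 (N G _≟_ h S) (2 ^ D) (subst (0 <_) (sym tight) (m^n>0 2 (suc (length S)))))
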